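{- Let $\mathcal G$ be a finite abelian group of exponent $m$ and let $C$ be a cycle. Then $C$ is zero-forcing for $\mathcal G$ if and only if $|V(C)|\geq 1+\frac{m-1}{m}|\mathcal G|$.
   Context: The exponent of $\mathcal G$ is the minimum positive integer $m$ with $mx=0$ for all $x\in\mathcal G$. A $\mathcal G$-labeling of a graph $G$ is a map $\ell: V(G)\to\mathcal G$, extended by $\ell(A)=\sum_{x\in A}\ell(x)$. A set $A\subseteq V(G)$ is connected if $G[A]$ is connected. $(G,\ell)$ is zero-avoiding if $\ell(A)\neq0$ for every non-empty connected $A\subseteq V(G)$. $G$ is zero-forcing for $\mathcal G$ if no $\mathcal G$-labeling $\ell$ makes $(G,\ell)$ zero-avoiding. -}

module Defs where

open import Level using (Level; _⊔_)
open import Algebra.Bundles using (AbelianGroup)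
open import Data.Nat using (ℕ; zero; suc; _+_; _*_; _≤_; _<_; _%_)
open import Data.Fin using (Fin; toℕ)
open import Data.Fin.Subset using (Subset; _∈_; Nonempty)
open import Data.Vec using ([]; _∷_)
open import Data.Bool using (true; false)
open import Data.Product using (Σ; ∃; _×_; _,_)
open import Data.Sum using (_⊎_)
open import Relation.Nullary using (¬_)
open import Data.Empty using (⊥)
open import Relation.Binary.PropositionalEquality using (_≡_)
import Algebra.Definitions.RawMonoid as RM

module _ {c ℓ : Level} (G : AbelianGroup c ℓ) where
  open AbelianGroup G

  infixr 8 _·_
  _·_ : ℕ → Carrier → Carrier
  _·_ = RM._×_ rawMonoid

  record HasSize (k : ℕ) : Set (c ⊔ ℓ) where
    field
      enum       : Fin k → Carrier
      injective  : ∀ i j → enum i ≈ enum j → i ≡ j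
      surjective : ∀ x → ∃ λ i → enum i ≈ x

  IsExponent : ℕ → Set (c ⊔ ℓ)
  IsExponent m =
    (0 < m) × (∀ x → m · x ≈ ε) ×
    (∀ m' → 0 < m' → (∀ x → m' · x ≈ ε) → m ≤ m')

  sumOver : ∀ {n} → Subset n → (Fin n → Carrier) → Carrier
  sumOver [] f = ε
  sumOver (true ∷ s) f = f Fin.zero ∙ sumOver s (λ i → f (Fin.suc i))
  sumOver (false ∷ s) f = sumOver s (λ i → f (Fin.suc i))

Graph : ℕ → Set₁
Graph n = Fin n → Fin n → Set

data WalkIn {n} (E : Graph n) (A : Subset n) : Fin n → Fin n → Set where
  here : ∀ {x} → x ∈ A → WalkIn E A x x
  step : ∀ {x y z} → x ∈ A → E x y → WalkIn E A y z → WalkIn E A x z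

Connected : ∀ {n} → Graph n → Subset n → Set
Connected E A = ∀ x y → x ∈ A → y ∈ A → WalkIn E A x y

cycleGraph : (n : ℕ) → Graph n
-- (for n = 0 the vertex set is empty, so this case is vacuous)
cycleGraph zero i j = ⊥
cycleGraph n@(suc _) i j =
  (toℕ j ≡ (toℕ i + 1) % n) ⊎ (toℕ i ≡ (toℕ j + 1) % n)

module _ {c ℓ : Level} (G : AbelianGroup c ℓ) where
  open AbelianGroup G

  ZeroAvoiding : ∀ {n} → Graph n → (Fin n → Carrier) → Set ℓ
  ZeroAvoiding E lab =
    ∀ A → Nonempty A → Connected E A → ¬ (sumOver G A lab ≈ ε)

  ZeroForcing : ∀ {n} → Graph n → Set (c ⊔ ℓ)
  ZeroForcing E = ∀ (lab : Fin _ → Carrier) → ¬ ZeroAvoiding E lab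

module Submission where

-- Write s t for the sum of the labels on the first t vertices of the cycle C_N and T = s N.
-- A labelling is zero-avoiding iff s 0, …, s N are distinct and s j ≠ s i + T for 0 < i ≤ j ≤ N,
-- since the nonempty connected vertex sets are the arcs [i, j) and the complements of arcs.
-- For a zero-avoiding labelling every orbit x, x + T, …, x + (m - 1) T leaves {s 1, …, s N}
-- (inside it the index would drop at each of the m steps around the orbit), so counting pairs
-- in Fin m × G gives k + m N ≤ m k, which contradicts the bound.
-- Conversely, the exponent m is the order of some h. With representatives r₀ = 0, r₁, … of
-- distinct cosets of ⟨h⟩, the prefix sums r_q + a h (a < m - 1) in lexicographic order, closed
-- by T = (m - 1) h = - h, satisfy the criterion as long as N violates the bound.

import Defs
open Defs hiding (_·_)
open import Level using (Level)
open import Algebra.Bundles using (AbelianGroup)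
import Data.Bool as Bool
open import Data.Bool using (Bool; true; false; not; _∧_; _∨_)
open import Data.Bool.Properties using (∨-inverseʳ; ∧-inverseʳ; ∧-identityʳ; ¬-not)
open import Data.Empty using (⊥)
import Data.Nat as ℕ
open import Data.Nat
  using (ℕ; zero; suc; pred; _+_; _*_; _∸_; _^_; _≤_; _<_; z≤n; s≤s; _<ᵇ_; _≡ᵇ_; _≤?_; _<?_; _%_; _/_;
         NonZero; >-nonZero; >-nonZero⁻¹; nonTrivial⇒n>1)
open import Data.Nat.Properties
open import Data.Nat.DivMod using (m≡m%n+[m/n]*n; m%n<n; m<n⇒m%n≡m; n%n≡0; /-monoˡ-≤; m/n*n≤m; 0/n≡0)
open import Data.Nat.Divisibility
  using (_∣_; divides; _∣?_; 1∣_; ∣1⇒≡1; m∣m*n; ∣-trans; m%n≡0⇒n∣m; *-cancelˡ-∣; ∣⇒≤)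
open import Data.Nat.Coprimality as Coprime using (Coprime; coprime-divisor)
open import Data.Nat.Induction using (<-rec)
open import Data.Nat.Primality using (Prime; prime⇒irreducible; prime⇒nonTrivial; prime⇒nonZero)
open import Data.Nat.Primality.Factorisation using (factorise)
open import Data.Nat.ListAction using (product)
open import Data.List using ([]; _∷_)
open import Data.List.Relation.Unary.All using (_∷_)
open import Data.Fin as Fin using (Fin; toℕ; fromℕ; fromℕ<)
open import Data.Fin.Properties
  using (toℕ<n; toℕ-fromℕ<; toℕ-fromℕ; toℕ-injective; toℕ≤pred[n]; any?; ¬∀⟶∃¬; injective⇒≤; +↔⊎; *↔×)
open import Data.Fin.Subset using (Subset; _∈_)
open import Data.Fin.Subset.Properties using (drop-there)
open import Data.Vec using ([]; _∷_; here; there)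
open import Data.Product using (∃; ∃₂; _×_; _,_; proj₁; proj₂)
open import Data.Sum using (_⊎_; inj₁; inj₂; swap)
open import Data.Sum.Function.Propositional using (_⊎-↔_)
open import Function using (_∘_; case_of_; Injection; Injective; mk↣)
open import Function.Construct.Composition using (_↣-∘_)
open import Function.Construct.Identity using (↔-id)
open import Function.Properties.Inverse using (↔⇒↣; ↔-sym)
open import Relation.Nullary using (¬_; Dec; yes; no; contradiction; ¬?)
open import Relation.Nullary.Decidable using (decidable-stable)
open import Relation.Nullary.Reflects using (Reflects; ofʸ; ofⁿ; ¬-reflects; _×-reflects_)
open import Relation.Unary using (Pred; Decidable)
open import Relation.Binary.Definitions using (tri<; tri≈; tri>)
import Relation.Binary.Reasoning.Setoid
open import Relation.Binary.PropositionalEquality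
  using (_≡_; _≢_; refl; sym; trans; cong; cong₂; subst; subst₂; ≢-sym)

module _ {p} {P : Pred ℕ p} (P? : Decidable P) where

  least : ∀ lo hi → (∀ z → lo ≤ z → z < hi → ¬ P z) ⊎
          ∃ λ f → lo ≤ f × f < hi × P f × (∀ z → lo ≤ z → z < f → ¬ P z)
  least lo zero = inj₁ λ _ _ ()
  least lo (suc hi) with least lo hi
  ... | inj₂ (f , lo≤f , f<hi , Pf , min) = inj₂ (f , lo≤f , m<n⇒m<1+n f<hi , Pf , min)
  ... | inj₁ none with lo ≤? hi | P? hi
  ...   | yes lo≤hi | yes Phi = inj₂ (hi , lo≤hi , n<1+n hi , Phi , none)
  ...   | yes _     | no ¬Phi = inj₁ λ z lo≤z z<1+hi → case m<1+n⇒m<n∨m≡n z<1+hi of λ where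
          (inj₁ z<hi) → none z lo≤z z<hi
          (inj₂ refl) → ¬Phi
  ...   | no lo≰hi  | _       = inj₁ λ z lo≤z z<1+hi → contradiction (≤-trans lo≤z (≤-pred z<1+hi)) lo≰hi

  greatest : ∀ hi → (∀ z → z < hi → ¬ P z) ⊎
             ∃ λ l → l < hi × P l × (∀ z → l < z → z < hi → ¬ P z)
  greatest zero = inj₁ λ _ ()
  greatest (suc hi) with P? hi
  ... | yes Phi = inj₂ (hi , n<1+n hi , Phi , λ z hi<z z<1+hi → contradiction (≤-pred z<1+hi) (<⇒≱ hi<z))
  ... | no ¬Phi with greatest hi
  ...   | inj₁ none = inj₁ λ z z<1+hi → case m<1+n⇒m<n∨m≡n z<1+hi of λ where
          (inj₁ z<hi) → none z z<hi
          (inj₂ refl) → ¬Phi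
  ...   | inj₂ (l , l<hi , Pl , max) = inj₂ (l , m<n⇒m<1+n l<hi , Pl , λ z l<z z<1+hi →
          case m<1+n⇒m<n∨m≡n z<1+hi of λ where
            (inj₁ z<hi) → max z l<z z<hi
            (inj₂ refl) → ¬Phi)

module _ {a} {A : Set a} where

  reflects-≡true⁺ : ∀ {b} → Reflects A b → A → b ≡ true
  reflects-≡true⁺ (ofʸ _)  _ = refl
  reflects-≡true⁺ (ofⁿ ¬x) x = contradiction x ¬x

  reflects-≡true⁻ : ∀ {b} → Reflects A b → b ≡ true → A
  reflects-≡true⁻ (ofʸ x) _ = x

subset : (n : ℕ) → (ℕ → Bool) → Subset n
subset zero    f = []
subset (suc n) f = f 0 ∷ subset n (f ∘ suc)

indicator : ∀ {n} → Subset n → ℕ → Bool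
indicator []      _       = false
indicator (b ∷ A) zero    = b
indicator (b ∷ A) (suc z) = indicator A z

∈⇒indicator : ∀ {n} {A : Subset n} {x} → x ∈ A → indicator A (toℕ x) ≡ true
∈⇒indicator here      = refl
∈⇒indicator (there p) = ∈⇒indicator p

indicator⇒∈ : ∀ {n} (A : Subset n) x → indicator A (toℕ x) ≡ true → x ∈ A
indicator⇒∈ (true ∷ A) Fin.zero    _ = here
indicator⇒∈ (b ∷ A)    (Fin.suc x) e = there (indicator⇒∈ A x e)

indicator-subset : ∀ n f {z} → z < n → indicator (subset n f) z ≡ f z
indicator-subset (suc n) f {zero}  _         = refl
indicator-subset (suc n) f {suc z} (s≤s z<n) = indicator-subset n (f ∘ suc) z<n

subset-cong : ∀ n {f g} → (∀ {z} → z < n → f z ≡ g z) → subset n f ≡ subset n g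
subset-cong zero    _   = refl
subset-cong (suc n) f≗g rewrite f≗g {0} (s≤s z≤n) = cong (_ ∷_) (subset-cong n (f≗g ∘ s≤s))

subset-≗ : ∀ {n} (A : Subset n) f →
           (∀ x → x ∈ A → f (toℕ x) ≡ true) → (∀ x → f (toℕ x) ≡ true → x ∈ A) → A ≡ subset n f
subset-≗ []      f _ _ = refl
subset-≗ (b ∷ A) f ⊆ ⊇ =
  cong₂ _∷_ (head b (⊆ Fin.zero) (⊇ Fin.zero))
            (subset-≗ A (f ∘ suc) (λ x → ⊆ (Fin.suc x) ∘ there) (λ x → drop-there ∘ ⊇ (Fin.suc x)))
  where
    head : ∀ b → (Fin.zero ∈ b ∷ A → f 0 ≡ true) → (f 0 ≡ true → Fin.zero ∈ b ∷ A) → b ≡ f 0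
    head true  ⊆₀ _  = sym (⊆₀ here)
    head false _  ⊇₀ = sym (¬-not λ f0 → case ⊇₀ f0 of λ ())

∈-subset⁺ : ∀ {n} f {x : Fin n} → f (toℕ x) ≡ true → x ∈ subset n f
∈-subset⁺ f {x} fx = indicator⇒∈ _ x (trans (indicator-subset _ f (toℕ<n x)) fx)

∈-subset⁻ : ∀ {n} f {x : Fin n} → x ∈ subset n f → f (toℕ x) ≡ true
∈-subset⁻ f {x} x∈ = trans (sym (indicator-subset _ f (toℕ<n x))) (∈⇒indicator x∈)

below : ℕ → ℕ → Bool
below t z = z <ᵇ t

between : ℕ → ℕ → ℕ → Bool
between i j z = not (z <ᵇ i) ∧ (z <ᵇ j)

outside : ℕ → ℕ → ℕ → Bool
outside i j z = not (between i j z)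

between-reflects : ∀ i j z → Reflects (¬ z < i × z < j) (between i j z)
between-reflects i j z = ¬-reflects (<ᵇ-reflects-< z i) ×-reflects <ᵇ-reflects-< z j

below⁺ : ∀ {t z} → z < t → below t z ≡ true
below⁺ {t} {z} = reflects-≡true⁺ (<ᵇ-reflects-< z t)

module _ (i j : ℕ) {z : ℕ} where

  between⁺ : i ≤ z → z < j → between i j z ≡ true
  between⁺ i≤z z<j = reflects-≡true⁺ (between-reflects i j z) (≤⇒≯ i≤z , z<j)

  between⁻ : between i j z ≡ true → i ≤ z × z < j
  between⁻ e with reflects-≡true⁻ (between-reflects i j z) e
  ... | z≮i , z<j = ≮⇒≥ z≮i , z<j

  outside⁺ : z < i ⊎ j ≤ z → outside i j z ≡ true
  outside⁺ side = reflects-≡true⁺ (¬-reflects (between-reflects i j z)) λ where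
    (z≮i , z<j) → case side of λ where
      (inj₁ z<i) → z≮i z<i
      (inj₂ j≤z) → <⇒≱ z<j j≤z

  outside⁻ : outside i j z ≡ true → z < i ⊎ j ≤ z
  outside⁻ e with z <? i
  ... | yes z<i = inj₁ z<i
  ... | no  z≮i = inj₂ (≮⇒≥ λ z<j → reflects-≡true⁻ (¬-reflects (between-reflects i j z)) e (z≮i , z<j))

outside-zero : ∀ {j n z} → z < n → outside 0 j z ≡ between j n z
outside-zero {j} {n} {z} z<n = sym (trans (cong (not (z <ᵇ j) ∧_) (below⁺ z<n)) (∧-identityʳ _))

between-singleton : ∀ t z → between t (suc t) z ≡ (z ≡ᵇ t)
between-singleton zero    zero    = refl
between-singleton zero    (suc z) = refl
between-singleton (suc t) zero    = refl
between-singleton (suc t) (suc z) = between-singleton t z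

below-split : ∀ {i j} → i ≤ j → ∀ z → below j z ≡ below i z ∨ between i j z
below-split {i} {j} i≤j z with z <ᵇ i | <ᵇ-reflects-< z i
... | true  | ofʸ z<i = below⁺ (<-≤-trans z<i i≤j)
... | false | ofⁿ _   = refl

below-between-disjoint : ∀ i j z → below i z ∧ between i j z ≡ false
below-between-disjoint i j z with z <ᵇ i
... | true  = refl
... | false = refl

module _ {c ℓ} (G : AbelianGroup c ℓ) where
  open AbelianGroup G renaming (refl to ≈-refl; sym to ≈-sym; trans to ≈-trans)
  open import Algebra.Properties.AbelianGroup G using (xyx⁻¹≈y)
  open import Algebra.Properties.CommutativeSemigroup commutativeSemigroup using (x∙yz≈y∙xz)
  open import Relation.Binary.Reasoning.Setoid setoid

  sumWhere : ∀ n → (ℕ → Bool) → (Fin n → Carrier) → Carrier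
  sumWhere n f lab = sumOver G (subset n f) lab

  sumWhere-cong : ∀ n {f g} lab → (∀ {z} → z < n → f z ≡ g z) → sumWhere n f lab ≈ sumWhere n g lab
  sumWhere-cong n lab f≗g rewrite subset-cong n f≗g = ≈-refl

  sumWhere-none : ∀ n {f} lab → (∀ {z} → z < n → f z ≡ false) → sumWhere n f lab ≈ ε
  sumWhere-none zero    lab _ = ≈-refl
  sumWhere-none (suc n) {f} lab f≗false with f 0 | f≗false {0} (s≤s z≤n)
  ... | false | refl = sumWhere-none n (lab ∘ Fin.suc) (f≗false ∘ s≤s)

  sumWhere-∨ : ∀ n {f g h} lab →
               (∀ {z} → z < n → h z ≡ f z ∨ g z) → (∀ {z} → z < n → f z ∧ g z ≡ false) →
               sumWhere n h lab ≈ sumWhere n f lab ∙ sumWhere n g lab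
  sumWhere-∨ zero    lab _ _ = ≈-sym (identityˡ ε)
  sumWhere-∨ (suc n) {f} {g} {h} lab h≗f∨g disjoint
    with f 0 | g 0 | h 0 | h≗f∨g {0} (s≤s z≤n) | disjoint {0} (s≤s z≤n)
       | sumWhere-∨ n {f ∘ suc} {g ∘ suc} {h ∘ suc} (lab ∘ Fin.suc) (h≗f∨g ∘ s≤s) (disjoint ∘ s≤s)
  ... | true  | false | _ | refl | _ | ih = ≈-trans (∙-congˡ ih) (≈-sym (assoc _ _ _))
  ... | false | true  | _ | refl | _ | ih = ≈-trans (∙-congˡ ih) (x∙yz≈y∙xz _ _ _)
  ... | false | false | _ | refl | _ | ih = ih

  sumWhere-single : ∀ n (x : Fin n) lab {f} → (∀ {z} → z < n → f z ≡ (z ≡ᵇ toℕ x)) → sumWhere n f lab ≈ lab x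
  sumWhere-single (suc n) Fin.zero lab {f} f≗ with f 0 | f≗ {0} (s≤s z≤n)
  ... | true | refl = ≈-trans (∙-congˡ (sumWhere-none n (lab ∘ Fin.suc) (f≗ ∘ s≤s))) (identityʳ _)
  sumWhere-single (suc n) (Fin.suc x) lab {f} f≗ with f 0 | f≗ {0} (s≤s z≤n)
  ... | false | refl = sumWhere-single n x (lab ∘ Fin.suc) (f≗ ∘ s≤s)

  module _ {n} (lab : Fin n → Carrier) where

    sumBelow : ℕ → Carrier
    sumBelow t = sumWhere n (below t) lab

    sumBetween : ℕ → ℕ → Carrier
    sumBetween i j = sumWhere n (between i j) lab

    sumOutside : ℕ → ℕ → Carrier
    sumOutside i j = sumWhere n (outside i j) lab

    sumAll : Carrier
    sumAll = sumWhere n (λ _ → true) lab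

    sumBelow-zero : sumBelow 0 ≈ ε
    sumBelow-zero = sumWhere-none n lab λ _ → refl

    sumBelow-all : sumBelow n ≈ sumAll
    sumBelow-all = sumWhere-cong n lab below⁺

    sumBelow-split : ∀ {i j} → i ≤ j → sumBelow j ≈ sumBelow i ∙ sumBetween i j
    sumBelow-split {i} {j} i≤j =
      sumWhere-∨ n lab (λ {z} _ → below-split i≤j z) (λ {z} _ → below-between-disjoint i j z)

    sumAll-split : ∀ i j → sumAll ≈ sumBetween i j ∙ sumOutside i j
    sumAll-split i j =
      sumWhere-∨ n lab (λ {z} _ → sym (∨-inverseʳ (between i j z))) (λ {z} _ → ∧-inverseʳ (between i j z))

    sumBelow-suc : ∀ x → sumBelow (suc (toℕ x)) ≈ sumBelow (toℕ x) ∙ lab x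
    sumBelow-suc x = ≈-trans (sumBelow-split (n≤1+n _))
      (∙-congˡ (sumWhere-single n x lab λ {z} _ → between-singleton (toℕ x) z))

  differences : ∀ {n} → (ℕ → Carrier) → Fin n → Carrier
  differences σ x = σ (suc (toℕ x)) - σ (toℕ x)

  sumBelow-differences : ∀ {n} (σ : ℕ → Carrier) → σ 0 ≈ ε → ∀ {t} → t ≤ n →
                         sumBelow {n} (differences σ) t ≈ σ t
  sumBelow-differences {n} σ σ0 {zero} _ = ≈-trans (sumBelow-zero (differences {n} σ)) (≈-sym σ0)
  sumBelow-differences {n} σ σ0 {suc t} t<n = begin
    sumBelow lab (suc t)                      ≡⟨ cong (sumBelow lab ∘ suc) (sym t≡x) ⟩
    sumBelow lab (suc (toℕ x))                ≈⟨ sumBelow-suc lab x ⟩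
    sumBelow lab (toℕ x) ∙ lab x              ≡⟨ cong (λ u → sumBelow lab u ∙ (σ (suc u) - σ u)) t≡x ⟩
    sumBelow lab t ∙ (σ (suc t) - σ t)        ≈⟨ ∙-congʳ (sumBelow-differences σ σ0 (<⇒≤ t<n)) ⟩
    σ t ∙ (σ (suc t) - σ t)                   ≈⟨ ≈-sym (assoc _ _ _) ⟩
    σ t ∙ σ (suc t) ∙ σ t ⁻¹                  ≈⟨ xyx⁻¹≈y _ _ ⟩
    σ (suc t)                                 ∎
    where
      lab = differences {n} σ
      x : Fin n
      x = Fin.fromℕ< t<n
      t≡x : toℕ x ≡ t
      t≡x = toℕ-fromℕ< t<n

-- Walks and connected sets in the cycle

module _ {n} {E : Graph n} {A : Subset n} where

  walk-source : ∀ {x y} → WalkIn E A x y → x ∈ A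
  walk-source (here x∈)     = x∈
  walk-source (step x∈ _ _) = x∈

  _++ʷ_ : ∀ {x y z} → WalkIn E A x y → WalkIn E A y z → WalkIn E A x z
  here _       ++ʷ w′ = w′
  step x∈ e w  ++ʷ w′ = step x∈ e (w ++ʷ w′)

  walk-reverse : (∀ {x y} → E x y → E y x) → ∀ {x y} → WalkIn E A x y → WalkIn E A y x
  walk-reverse E-sym (here x∈)    = here x∈
  walk-reverse E-sym (step x∈ e w) = walk-reverse E-sym w ++ʷ step (walk-source w) (E-sym e) (here x∈)

module Cycle (n : ℕ) where

  N : ℕ
  N = suc n

  E : Graph N
  E = cycleGraph N

  E-sym : ∀ {x y} → E x y → E y x
  E-sym = swap

  last : Fin N
  last = fromℕ n

  private
    suc-mod : ∀ {a} → a < n → (a + 1) % N ≡ suc a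
    suc-mod {a} a<n = trans (cong (_% N) (+-comm a 1)) (m<n⇒m%n≡m (s≤s a<n))

    n+1-mod : (n + 1) % N ≡ 0
    n+1-mod = trans (cong (_% N) (+-comm n 1)) (n%n≡0 N)

  edge-suc : ∀ {x y} → toℕ y ≡ suc (toℕ x) → E x y
  edge-suc {x} {y} y≡1+x = inj₁ (trans y≡1+x (sym (suc-mod (≤-pred (subst (_< N) y≡1+x (toℕ<n y))))))

  edge-wrap : E last Fin.zero
  edge-wrap = inj₁ (sym (trans (cong (λ t → (t + 1) % N) (toℕ-fromℕ n)) n+1-mod))

  data Adjacency (x y : Fin N) : Set where
    forward       : toℕ y ≡ suc (toℕ x) → Adjacency x y
    backward      : toℕ x ≡ suc (toℕ y) → Adjacency x y
    wrap-forward  : toℕ x ≡ n → Adjacency x y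
    wrap-backward : toℕ x ≡ 0 → Adjacency x y

  adjacency : ∀ {x y} → E x y → Adjacency x y
  adjacency {x} {y} (inj₁ y≡) with m<1+n⇒m<n∨m≡n (toℕ<n x)
  ... | inj₁ x<n = forward (trans y≡ (suc-mod x<n))
  ... | inj₂ x≡n = wrap-forward x≡n
  adjacency {x} {y} (inj₂ x≡) with m<1+n⇒m<n∨m≡n (toℕ<n y)
  ... | inj₁ y<n = backward (trans x≡ (suc-mod y<n))
  ... | inj₂ y≡n = wrap-backward (trans x≡ (trans (cong (λ t → (t + 1) % N) y≡n) n+1-mod))

  walk-up : ∀ {A} d {x y : Fin N} → toℕ y ≡ d + toℕ x →
            (∀ {z} → toℕ x ≤ toℕ z → toℕ z ≤ toℕ y → z ∈ A) → WalkIn E A x y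
  walk-up zero {x} {y} y≡x inA with toℕ-injective y≡x
  ... | refl = here (inA ≤-refl ≤-refl)
  walk-up {A} (suc d) {x} {y} y≡ inA =
    step (inA ≤-refl (subst (toℕ x ≤_) (sym y≡) (m≤n+m _ _))) (edge-suc x′≡) (walk-up d y≡′ inA′)
    where
      1+x≡ : toℕ y ≡ d + suc (toℕ x)
      1+x≡ = trans y≡ (sym (+-suc d (toℕ x)))
      1+x<N : suc (toℕ x) < N
      1+x<N = ≤-<-trans (subst (suc (toℕ x) ≤_) (sym 1+x≡) (m≤n+m _ d)) (toℕ<n y)
      x′ : Fin N
      x′ = fromℕ< 1+x<N
      x′≡ : toℕ x′ ≡ suc (toℕ x)
      x′≡ = toℕ-fromℕ< 1+x<N
      y≡′ : toℕ y ≡ d + toℕ x′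
      y≡′ = trans 1+x≡ (cong (d +_) (sym x′≡))
      inA′ : ∀ {z} → toℕ x′ ≤ toℕ z → toℕ z ≤ toℕ y → z ∈ A
      inA′ {z} x′≤z = inA (≤-trans (n≤1+n _) (subst (_≤ toℕ z) x′≡ x′≤z))

  walk-in-segment : ∀ {A lo hi} → (∀ {z : Fin N} → lo ≤ toℕ z → toℕ z < hi → z ∈ A) →
                    ∀ {x y} → lo ≤ toℕ x → toℕ x < hi → lo ≤ toℕ y → toℕ y < hi → WalkIn E A x y
  walk-in-segment inA {x} {y} lo≤x x<hi lo≤y y<hi with ≤-total (toℕ x) (toℕ y)
  ... | inj₁ x≤y = walk-up (toℕ y ∸ toℕ x) (sym (m∸n+n≡m x≤y))
                     λ x≤z z≤y → inA (≤-trans lo≤x x≤z) (≤-<-trans z≤y y<hi)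
  ... | inj₂ y≤x = walk-reverse E-sym (walk-up (toℕ x ∸ toℕ y) (sym (m∸n+n≡m y≤x))
                     λ y≤z z≤x → inA (≤-trans lo≤y y≤z) (≤-<-trans z≤x x<hi))

  between-connected : ∀ i j → Connected E (subset N (between i j))
  between-connected i j x y x∈ y∈
    with between⁻ i j (∈-subset⁻ (between i j) x∈) | between⁻ i j (∈-subset⁻ (between i j) y∈)
  ... | i≤x , x<j | i≤y , y<j =
    walk-in-segment (λ i≤z z<j → ∈-subset⁺ (between i j) (between⁺ i j i≤z z<j)) i≤x x<j i≤y y<j

  module _ (i j : ℕ) where
    private
      Out = subset N (outside i j)

      ∈-low : ∀ {z : Fin N} → toℕ z < i → z ∈ Out
      ∈-low z<i = ∈-subset⁺ (outside i j) (outside⁺ i j (inj₁ z<i))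

      ∈-high : ∀ {z : Fin N} → j ≤ toℕ z → z ∈ Out
      ∈-high j≤z = ∈-subset⁺ (outside i j) (outside⁺ i j (inj₂ j≤z))

      low : ∀ {x y} → toℕ x < i → toℕ y < i → WalkIn E Out x y
      low x<i y<i = walk-in-segment (λ _ → ∈-low) z≤n x<i z≤n y<i

      high : ∀ {x y} → j ≤ toℕ x → j ≤ toℕ y → WalkIn E Out x y
      high {x} {y} j≤x j≤y = walk-in-segment (λ j≤z _ → ∈-high j≤z) j≤x (toℕ<n x) j≤y (toℕ<n y)

      j≤last : ∀ {z : Fin N} → j ≤ toℕ z → j ≤ toℕ last
      j≤last {z} j≤z = subst (j ≤_) (sym (toℕ-fromℕ n)) (≤-trans j≤z (toℕ≤pred[n] z))

      0<i : ∀ {z : Fin N} → toℕ z < i → 0 < i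
      0<i = ≤-<-trans z≤n

    outside-connected : Connected E Out
    outside-connected x y x∈ y∈
      with outside⁻ i j (∈-subset⁻ (outside i j) x∈) | outside⁻ i j (∈-subset⁻ (outside i j) y∈)
    ... | inj₁ x<i | inj₁ y<i = low x<i y<i
    ... | inj₂ j≤x | inj₂ j≤y = high j≤x j≤y
    ... | inj₁ x<i | inj₂ j≤y =
      low x<i (0<i x<i) ++ʷ step (∈-low (0<i x<i)) (E-sym edge-wrap) (high (j≤last j≤y) j≤y)
    ... | inj₂ j≤x | inj₁ y<i =
      high j≤x (j≤last j≤x) ++ʷ step (∈-high (j≤last j≤x)) edge-wrap (low (0<i y<i) y<i)

  ∉⇒≢ : ∀ {A : Subset N} {c x} → indicator A c ≡ false → x ∈ A → toℕ x ≢ c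
  ∉⇒≢ c∉ x∈ refl = case trans (sym (∈⇒indicator x∈)) c∉ of λ ()

  walk-confined : ∀ {A b c} → indicator A b ≡ false → indicator A c ≡ false → c < N →
                  ∀ {y z} → b < toℕ y → toℕ y < c → WalkIn E A y z → b < toℕ z × toℕ z < c
  walk-confined b∉ c∉ c<N b<y y<c (here _) = b<y , y<c
  walk-confined b∉ c∉ c<N b<y y<c (step _ e w) with adjacency e
  ... | forward y′≡ = walk-confined b∉ c∉ c<N (subst (_ <_) (sym y′≡) (m<n⇒m<1+n b<y))
                        (≤∧≢⇒< (subst (_≤ _) (sym y′≡) y<c) (∉⇒≢ c∉ (walk-source w))) w
  ... | backward y≡ = walk-confined b∉ c∉ c<N
                        (≤∧≢⇒< (≤-pred (subst (_ <_) y≡ b<y)) (≢-sym (∉⇒≢ b∉ (walk-source w))))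
                        (<-trans (subst (_ <_) (sym y≡) (n<1+n _)) y<c) w
  ... | wrap-forward y≡n  = contradiction (<-≤-trans y<c (≤-pred c<N)) (<-irrefl y≡n)
  ... | wrap-backward y≡0 = contradiction (subst (_ <_) y≡0 b<y) n≮0

  data Shape (A : Subset N) : Set where
    interval    : ∀ {a c} → a < c → c ≤ N → A ≡ subset N (between a c) → Shape A
    co-interval : ∀ {b a} → 0 < b → b ≤ a → a ≤ N → A ≡ subset N (outside b a) → Shape A

  outside-shape : ∀ {A f l} → f ≤ l → l < N → (f ≡ 0 → suc l < N) → A ≡ subset N (outside f (suc l)) → Shape A
  outside-shape {f = suc _}     f≤l l<N _     A≡ = co-interval (s≤s z≤n) (m≤n⇒m≤1+n f≤l) l<N A≡
  outside-shape {f = zero} {l} _   _   1+l<N A≡ =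
    interval (1+l<N refl) ≤-refl (trans A≡ (subset-cong N (outside-zero {suc l} {N})))

  module _ {A : Subset N} (conn : Connected E A) where

    private
      NonMember : ℕ → Set
      NonMember z = indicator A z ≡ false

      nonMember? : Decidable NonMember
      nonMember? z = indicator A z Bool.≟ false

      member : ∀ {x : Fin N} → ¬ NonMember (toℕ x) → x ∈ A
      member {x} x∈ = indicator⇒∈ A x (¬-not x∈)

      confined : ∀ {b c} → NonMember b → NonMember c → c < N → ∀ {x y} → x ∈ A → y ∈ A →
                 b < toℕ x → toℕ x < c → b < toℕ y × toℕ y < c
      confined b∉ c∉ c<N x∈ y∈ b<x x<c = walk-confined b∉ c∉ c<N b<x x<c (conn _ _ x∈ y∈)

    shape-around : ∀ {x₀ f l} → x₀ ∈ A → NonMember f → NonMember l → f < toℕ x₀ → toℕ x₀ < l → l < N →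
                   Shape A
    shape-around {x₀} x₀∈ f∉ l∉ f<x₀ x₀<l l<N
      with greatest nonMember? (toℕ x₀) | least nonMember? (suc (toℕ x₀)) N
    ... | inj₁ none | _         = contradiction f∉ (none _ f<x₀)
    ... | inj₂ _    | inj₁ none = contradiction l∉ (none _ x₀<l l<N)
    ... | inj₂ (b , b<x₀ , b∉ , b-max) | inj₂ (c , x₀<c , c<N , c∉ , c-min) =
      interval (≤-<-trans b<x₀ x₀<c) (<⇒≤ c<N) (subset-≗ A (between (suc b) c) ⊆ ⊇)
      where
        ⊆ : ∀ x → x ∈ A → between (suc b) c (toℕ x) ≡ true
        ⊆ x x∈ = let b<x , x<c = confined b∉ c∉ c<N x₀∈ x∈ b<x₀ x₀<c in between⁺ (suc b) c b<x x<c
        ⊇ : ∀ x → between (suc b) c (toℕ x) ≡ true → x ∈ A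
        ⊇ x x∈ with between⁻ (suc b) c x∈ | <-cmp (toℕ x) (toℕ x₀)
        ... | b<x , _   | tri< x<x₀ _ _ = member (b-max _ b<x x<x₀)
        ... | _         | tri≈ _ x≡x₀ _ = subst (_∈ A) (toℕ-injective (sym x≡x₀)) x₀∈
        ... | _ , x<c   | tri> _ _ x₀<x = member (c-min _ x₀<x x<c)

    shape-across : ∀ {x₀ f l} → x₀ ∈ A → NonMember f → NonMember l → l < N →
                   (∀ z → z < f → ¬ NonMember z) → (∀ z → l < z → z < N → ¬ NonMember z) →
                   toℕ x₀ < f ⊎ l < toℕ x₀ → Shape A
    shape-across {x₀} {f} {l} x₀∈ f∉ l∉ l<N f-min l-max x₀∉[f,l] =
      outside-shape (≮⇒≥ λ l<f → f-min l l<f l∉) l<N 1+l<N (subset-≗ A (outside f (suc l)) ⊆ ⊇)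
      where
        ⊆ : ∀ x → x ∈ A → outside f (suc l) (toℕ x) ≡ true
        ⊆ x x∈ with toℕ x <? f | l <? toℕ x
        ... | yes x<f | _       = outside⁺ f (suc l) (inj₁ x<f)
        ... | no _    | yes l<x = outside⁺ f (suc l) (inj₂ l<x)
        ... | no x≮f  | no x≯l  = contradiction x₀∉[f,l] λ where
              (inj₁ x₀<f) → <-asym x₀<f (proj₁ x₀∈[f,l])
              (inj₂ l<x₀) → <-asym l<x₀ (proj₂ x₀∈[f,l])
          where
            f<x = ≤∧≢⇒< (≮⇒≥ x≮f) (≢-sym (∉⇒≢ f∉ x∈))
            x<l = ≤∧≢⇒< (≮⇒≥ x≯l) (∉⇒≢ l∉ x∈)
            x₀∈[f,l] = confined f∉ l∉ l<N x∈ x₀∈ f<x x<l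
        ⊇ : ∀ x → outside f (suc l) (toℕ x) ≡ true → x ∈ A
        ⊇ x x∈ with outside⁻ f (suc l) x∈
        ... | inj₁ x<f = member (f-min _ x<f)
        ... | inj₂ l<x = member (l-max _ l<x (toℕ<n x))
        1+l<N : f ≡ 0 → suc l < N
        1+l<N refl = case x₀∉[f,l] of λ where
          (inj₂ l<x₀) → <-≤-trans (s≤s l<x₀) (toℕ<n x₀)

    -- With f and l the first and last non-members: if x₀ lies outside [f, l], A is the
    -- complement of [f, l]; otherwise A is the gap between the non-members nearest to x₀.
    shape : ∀ {x₀} → x₀ ∈ A → Shape A
    shape {x₀} x₀∈ with greatest nonMember? N
    ... | inj₁ none = interval (s≤s z≤n) ≤-refl
            (subset-≗ A (between 0 N) (λ x _ → between⁺ 0 N z≤n (toℕ<n x)) (λ x _ → member (none _ (toℕ<n x))))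
    ... | inj₂ (l , l<N , l∉ , l-max) with least nonMember? 0 N
    ...   | inj₁ none = contradiction l∉ (none l z≤n l<N)
    ...   | inj₂ (f , _ , _ , f∉ , f-min) with <-cmp (toℕ x₀) f | <-cmp (toℕ x₀) l
    ... | tri< x₀<f _ _ | _             = shape-across x₀∈ f∉ l∉ l<N (λ z → f-min z z≤n) l-max (inj₁ x₀<f)
    ... | tri≈ _ x₀≡f _ | _             = contradiction x₀≡f (∉⇒≢ f∉ x₀∈)
    ... | tri> _ _ f<x₀ | tri< x₀<l _ _ = shape-around x₀∈ f∉ l∉ f<x₀ x₀<l l<N
    ... | tri> _ _ _    | tri≈ _ x₀≡l _ = contradiction x₀≡l (∉⇒≢ l∉ x₀∈)
    ... | tri> _ _ _    | tri> _ _ l<x₀ = shape-across x₀∈ f∉ l∉ l<N (λ z → f-min z z≤n) l-max (inj₂ l<x₀)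

-- Zero-avoiding labellings of the cycle via prefix sums

module _ {c ℓ} (G : AbelianGroup c ℓ) (n : ℕ) where
  open AbelianGroup G renaming (refl to ≈-refl; sym to ≈-sym; trans to ≈-trans)
  open import Algebra.Properties.AbelianGroup G using (∙-cancelˡ; identityʳ-unique)
  open import Relation.Binary.Reasoning.Setoid setoid
  open Cycle n

  -- The arc [i, j) has sum s j - s i and its complement [0, i) ∪ [j, N) has sum T - (s j - s i);
  -- for i = 0 the latter vanishing means s j ≈ s N, which `distinct` already excludes.
  record PrefixSumCondition (lab : Fin N → Carrier) : Set ℓ where
    field
      distinct : ∀ {i j} → i < j → j ≤ N → ¬ sumBelow G lab i ≈ sumBelow G lab j
      no-wrap  : ∀ {i j} → 0 < i → i ≤ j → j ≤ N → ¬ sumBelow G lab j ≈ sumBelow G lab i ∙ sumAll G lab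

  module _ {lab : Fin N → Carrier} where

    private
      s : ℕ → Carrier
      s = sumBelow G lab

      T : Carrier
      T = sumAll G lab

      sum≈ε : ∀ {A} f → A ≡ subset N f → sumOver G A lab ≈ ε → sumWhere G N f lab ≈ ε
      sum≈ε _ refl A≈ε = A≈ε

    zeroAvoiding⇒prefixSumCondition : ZeroAvoiding G E lab → PrefixSumCondition lab
    zeroAvoiding⇒prefixSumCondition avoiding = record { distinct = distinct ; no-wrap = no-wrap }
      where
        distinct : ∀ {i j} → i < j → j ≤ N → ¬ s i ≈ s j
        distinct {i} {j} i<j j≤N si≈sj = avoiding (subset N (between i j)) (x , x∈) (between-connected i j)
          (identityʳ-unique (s i) _ (≈-sym (≈-trans si≈sj (sumBelow-split G lab (<⇒≤ i<j)))))
          where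
            i<N = <-≤-trans i<j j≤N
            x = fromℕ< i<N
            x≡i = toℕ-fromℕ< i<N
            x∈ = ∈-subset⁺ (between i j) (between⁺ i j (≤-reflexive (sym x≡i)) (subst (_< j) (sym x≡i) i<j))
        no-wrap : ∀ {i j} → 0 < i → i ≤ j → j ≤ N → ¬ s j ≈ s i ∙ T
        no-wrap {i} {j} 0<i i≤j j≤N sj≈si∙T =
          avoiding (subset N (outside i j)) (Fin.zero , ∈-subset⁺ (outside i j) (outside⁺ i j (inj₁ 0<i)))
            (outside-connected i j) (identityʳ-unique B _ (≈-sym B≈B∙O))
          where
            B = sumBetween G lab i j
            B≈T : B ≈ T
            B≈T = ∙-cancelˡ (s i) _ _ (≈-trans (≈-sym (sumBelow-split G lab i≤j)) sj≈si∙T)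
            B≈B∙O : B ≈ B ∙ sumOutside G lab i j
            B≈B∙O = ≈-trans B≈T (sumAll-split G lab i j)

    prefixSumCondition⇒zeroAvoiding : PrefixSumCondition lab → ZeroAvoiding G E lab
    prefixSumCondition⇒zeroAvoiding cond A (x₀ , x₀∈) conn A≈ε with shape conn x₀∈
    ... | interval {a} {c} a<c c≤N A≡ = distinct a<c c≤N (≈-sym (begin
      s c                           ≈⟨ sumBelow-split G lab (<⇒≤ a<c) ⟩
      s a ∙ sumBetween G lab a c    ≈⟨ ∙-congˡ (sum≈ε (between a c) A≡ A≈ε) ⟩
      s a ∙ ε                       ≈⟨ identityʳ (s a) ⟩
      s a                           ∎))
      where open PrefixSumCondition cond
    ... | co-interval {b} {a} 0<b b≤a a≤N A≡ = no-wrap 0<b b≤a a≤N (begin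
      s a                           ≈⟨ sumBelow-split G lab b≤a ⟩
      s b ∙ sumBetween G lab b a    ≈⟨ ∙-congˡ (≈-sym T≈B) ⟩
      s b ∙ T                       ∎)
      where
        open PrefixSumCondition cond
        T≈B : T ≈ sumBetween G lab b a
        T≈B = begin
          T                                                ≈⟨ sumAll-split G lab b a ⟩
          sumBetween G lab b a ∙ sumOutside G lab b a      ≈⟨ ∙-congˡ (sum≈ε (outside b a) A≡ A≈ε) ⟩
          sumBetween G lab b a ∙ ε                         ≈⟨ identityʳ _ ⟩
          sumBetween G lab b a                             ∎

-- Multiples in finite groups, and a counting bound for zero-avoiding labellings

module Multiples {c ℓ} (G : AbelianGroup c ℓ) where
  open AbelianGroup G renaming (refl to ≈-refl; trans to ≈-trans)
  open import Algebra.Properties.Monoid.Mult monoid using (×-homo-+; ×-assocˡ; ×-congʳ)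
  open import Algebra.Properties.CommutativeMonoid.Mult commutativeMonoid using (×-distrib-+)

  infixr 8 _·_
  _·_ : ℕ → Carrier → Carrier
  _·_ = Defs._·_ G

  ·-congʳ : ∀ n {x y} → x ≈ y → n · x ≈ n · y
  ·-congʳ = ×-congʳ

  ·-homo-+ : ∀ a b x → (a + b) · x ≈ a · x ∙ b · x
  ·-homo-+ a b x = ×-homo-+ x a b

  ·-assoc : ∀ a b x → a · b · x ≈ (a * b) · x
  ·-assoc a b x = ×-assocˡ x a b

  ·-distrib-∙ : ∀ n x y → n · (x ∙ y) ≈ n · x ∙ n · y
  ·-distrib-∙ n x y = ×-distrib-+ x y n

  ·-ε : ∀ n → n · ε ≈ ε
  ·-ε zero    = ≈-refl
  ·-ε (suc n) = ≈-trans (identityˡ _) (·-ε n)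

module Finite {c ℓ} (G : AbelianGroup c ℓ) {k} (size : HasSize G k) where
  open AbelianGroup G renaming (refl to ≈-refl; sym to ≈-sym; trans to ≈-trans)
  open HasSize size public

  index : Carrier → Fin k
  index x = proj₁ (surjective x)

  enum-index : ∀ x → enum (index x) ≈ x
  enum-index x = proj₂ (surjective x)

  index-injective : ∀ {x y} → index x ≡ index y → x ≈ y
  index-injective {x} {y} eq =
    ≈-trans (≈-sym (enum-index x)) (≈-trans (reflexive (cong enum eq)) (enum-index y))

  index-cong : ∀ {x y} → x ≈ y → index x ≡ index y
  index-cong {x} {y} x≈y = injective _ _ (≈-trans (enum-index x) (≈-trans x≈y (≈-sym (enum-index y))))

  _≈?_ : ∀ x y → Dec (x ≈ y)
  x ≈? y with index x Fin.≟ index y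
  ... | yes eq  = yes (index-injective eq)
  ... | no  neq = no (neq ∘ index-cong)

module _ {c ℓ} (G : AbelianGroup c ℓ) {k} (size : HasSize G k) where
  open AbelianGroup G renaming (refl to ≈-refl; sym to ≈-sym; trans to ≈-trans)
  open import Algebra.Properties.AbelianGroup G using (∙-cancelʳ)
  open import Algebra.Properties.CommutativeSemigroup commutativeSemigroup using (x∙yz≈xz∙y)
  private
    module ≈-Reasoning = Relation.Binary.Reasoning.Setoid setoid
  open Finite G size
  open Multiples G using (_·_)

  module _ (m : ℕ) .{{_ : NonZero m}} {T : Carrier} (mT≈ε : m · T ≈ ε) {N} (s : Fin N → Carrier)
           (s-injective : ∀ {i j} → s i ≈ s j → i ≡ j)
           (descending : ∀ {i j} → s j ≈ s i ∙ T → toℕ j < toℕ i) where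

    InImage : Carrier → Set ℓ
    InImage y = ∃ λ t → s t ≈ y

    private
      0<m : 0 < m
      0<m = >-nonZero⁻¹ m

    -- If the whole orbit of x under + T lay in the image of s, `descending` would lower the
    -- index at each of the m steps around the orbit, which closes up since m · T ≈ ε.

    module _ (x : Carrier) (hits : ∀ j → j < m → InImage (x ∙ j · T)) where

      private
        t₀ : Fin N
        t₀ = proj₁ (hits 0 0<m)

      descent : ∀ j → j < m → ∀ t → s t ≈ x ∙ j · T → toℕ t + j ≤ toℕ t₀
      descent zero _ t st≈x = ≤-reflexive (trans (+-identityʳ _)
        (cong toℕ (s-injective (≈-trans st≈x (≈-sym (proj₂ (hits 0 0<m)))))))
      descent (suc j) 1+j<m t st≈ = begin
        toℕ t + suc j    ≡⟨ +-suc (toℕ t) j ⟩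
        suc (toℕ t) + j  ≤⟨ +-monoˡ-≤ j (descending st≈st₁∙T) ⟩
        toℕ t₁ + j       ≤⟨ descent j j<m t₁ st₁≈ ⟩
        toℕ t₀           ∎
        where
          open ≤-Reasoning
          j<m = <-trans (n<1+n j) 1+j<m
          t₁ = proj₁ (hits j j<m)
          st₁≈ = proj₂ (hits j j<m)
          st≈st₁∙T : s t ≈ s t₁ ∙ T
          st≈st₁∙T = ≈-trans st≈ (≈-trans (x∙yz≈xz∙y x T (j · T)) (∙-congʳ (≈-sym st₁≈)))

      orbit-not-covered : ⊥
      orbit-not-covered = <⇒≱ (descending st₀≈st₁∙T) (≤-trans (m≤m+n _ _) (descent (pred m) M<m t₁ st₁≈))
        where
          open ≈-Reasoning
          M<m = subst (pred m <_) (suc-pred m) (n<1+n (pred m))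
          t₁ = proj₁ (hits (pred m) M<m)
          st₁≈ = proj₂ (hits (pred m) M<m)
          st₀≈st₁∙T : s t₀ ≈ s t₁ ∙ T
          st₀≈st₁∙T = begin
            s t₀                      ≈⟨ proj₂ (hits 0 0<m) ⟩
            x ∙ ε                     ≈⟨ ∙-congˡ (≈-sym mT≈ε) ⟩
            x ∙ m · T                 ≡⟨ cong (λ u → x ∙ u · T) (sym (suc-pred m)) ⟩
            x ∙ (T ∙ pred m · T)      ≈⟨ x∙yz≈xz∙y x T _ ⟩
            (x ∙ pred m · T) ∙ T      ≈⟨ ∙-congʳ (≈-sym st₁≈) ⟩
            s t₁ ∙ T                  ∎

    escape : ∀ x → ∃ λ (j : Fin m) → ¬ InImage (x ∙ toℕ j · T)
    escape x = ¬∀⟶∃¬ m _ (λ j → any? λ t → s t ≈? (x ∙ toℕ j · T)) λ all →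
      orbit-not-covered x λ j j<m → subst (λ u → InImage (x ∙ u · T)) (toℕ-fromℕ< j<m) (all (Fin.fromℕ< j<m))

    private
      jump : Carrier → Fin m
      jump x = proj₁ (escape x)

      -- The pairs (j, s t) and one escaping pair (jump x, x ∙ jump x · T) per x are distinct.
      encode : Fin k ⊎ (Fin m × Fin N) → Fin m × Fin k
      encode (inj₁ i)       = jump (enum i) , index (enum i ∙ toℕ (jump (enum i)) · T)
      encode (inj₂ (j , t)) = j , index (s t)

      encode-injective : Injective _≡_ _≡_ encode
      encode-injective {inj₁ i} {inj₁ i′} eq with cong proj₁ eq | index-injective (cong proj₂ eq)
      ... | j≡j′ | e = cong inj₁ (injective i i′ (∙-cancelʳ _ _ _
                         (≈-trans e (∙-congˡ (reflexive (cong (λ j → toℕ j · T) (sym j≡j′)))))))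
      encode-injective {inj₁ i} {inj₂ (_ , t)} eq =
        contradiction (t , ≈-sym (index-injective (cong proj₂ eq))) (proj₂ (escape (enum i)))
      encode-injective {inj₂ (_ , t)} {inj₁ i} eq =
        contradiction (t , index-injective (cong proj₂ eq)) (proj₂ (escape (enum i)))
      encode-injective {inj₂ (j , t)} {inj₂ (j′ , t′)} eq =
        cong₂ (λ a b → inj₂ (a , b)) (cong proj₁ eq) (s-injective (index-injective (cong proj₂ eq)))

    count : k + m * N ≤ m * k
    count = injective⇒≤ (Injection.injective
      (↔⇒↣ (↔-sym *↔×) ↣-∘ (mk↣ encode-injective ↣-∘ (↔⇒↣ (↔-id _ ⊎-↔ *↔×) ↣-∘ ↔⇒↣ +↔⊎))))

m*n>0⇒m>0 : ∀ m {n} → 0 < m * n → 0 < m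
m*n>0⇒m>0 m 0<mn = >-nonZero⁻¹ m {{m*n≢0⇒m≢0 m {{>-nonZero 0<mn}}}}

m*n>0⇒n>0 : ∀ m {n} → 0 < m * n → 0 < n
m*n>0⇒n>0 m {n} 0<mn = >-nonZero⁻¹ n {{m*n≢0⇒n≢0 m {{>-nonZero 0<mn}}}}

prime>1 : ∀ {p} → Prime p → 1 < p
prime>1 {p} pr = nonTrivial⇒n>1 p {{prime⇒nonTrivial pr}}

prime-divisor : ∀ {e} → 1 < e → ∃ λ p → Prime p × p ∣ e
prime-divisor {suc zero} (s≤s ())
prime-divisor {suc (suc _)} _ with factorise (suc (suc _))
... | record { factors = p ∷ ps ; isFactorisation = e≡ ; factorsPrime = pr ∷ _ } =
  p , pr , subst (p ∣_) (sym e≡) (m∣m*n (product ps))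

prime-power-split : ∀ {p} → Prime p → ∀ {e} → 0 < e → ∃₂ λ b e′ → e ≡ p ^ b * e′ × ¬ p ∣ e′
prime-power-split {p} pr {e} = <-rec _ split e
  where
    split : ∀ e → (∀ {e′} → e′ < e → 0 < e′ → ∃₂ λ b e″ → e′ ≡ p ^ b * e″ × ¬ p ∣ e″) →
            0 < e → ∃₂ λ b e′ → e ≡ p ^ b * e′ × ¬ p ∣ e′
    split e rec 0<e with p ∣? e
    ... | no p∤e = 0 , e , sym (+-identityʳ e) , p∤e
    ... | yes (divides q refl) with rec q<q*p 0<q
      where
        0<q : 0 < q
        0<q = n≢0⇒n>0 λ { refl → contradiction 0<e (<-irrefl refl) }
        q<q*p : q < q * p
        q<q*p = m<m*n q p {{>-nonZero 0<q}} (prime>1 pr)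
    ... | b , e′ , refl , p∤e′ = suc b , e′ , trans (*-comm (p ^ b * e′) p) (sym (*-assoc p (p ^ b) e′)) , p∤e′

prime∤⇒coprime : ∀ {p e} → Prime p → ¬ p ∣ e → Coprime p e
prime∤⇒coprime pr p∤e (d∣p , d∣e) with prime⇒irreducible pr d∣p
... | inj₁ d≡1 = d≡1
... | inj₂ refl = contradiction d∣e p∤e

coprime-* : ∀ {a b c} → Coprime a c → Coprime b c → Coprime (a * b) c
coprime-* {a} a⊥c b⊥c (d∣ab , d∣c) = b⊥c (coprime-divisor d⊥a d∣ab , d∣c)
  where
    d⊥a : Coprime _ a
    d⊥a (g∣d , g∣a) = a⊥c (g∣a , ∣-trans g∣d d∣c)

coprime-^ : ∀ {a c} b → Coprime a c → Coprime (a ^ b) c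
coprime-^ zero    _   (d∣1 , _) = ∣1⇒≡1 d∣1
coprime-^ (suc b) a⊥c = coprime-* a⊥c (coprime-^ b a⊥c)

coprime-*-∣ : ∀ {a b n} → Coprime a b → a ∣ n → b ∣ n → a * b ∣ n
coprime-*-∣ {a} {b} a⊥b (divides q refl) b∣qa
  with coprime-divisor (Coprime.sym a⊥b) (subst (b ∣_) (*-comm q a) b∣qa)
... | divides r refl = divides r (trans (*-assoc r b a) (cong (r *_) (*-comm b a)))

^-∣-^ : ∀ p {a b} → a ≤ b → p ^ a ∣ p ^ b
^-∣-^ p {a} {b} a≤b = divides (p ^ (b ∸ a)) (trans (cong (p ^_) (sym (m+[n∸m]≡n a≤b)))
  (trans (^-distribˡ-+-* p a (b ∸ a)) (*-comm (p ^ a) (p ^ (b ∸ a)))))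

prime-power>1 : ∀ {p} → Prime p → ∀ b {e} → p ∣ p ^ b * e → ¬ p ∣ e → 1 < p ^ b
prime-power>1 pr zero    p∣e p∤e = contradiction (subst (_ ∣_) (*-identityˡ _) p∣e) p∤e
prime-power>1 {p} pr (suc b) _ _ = *-mono-≤ (prime>1 pr) (m^n>0 p {{prime⇒nonZero pr}} b)

-- Orders of elements; the exponent is attained

module Orders {c ℓ} (G : AbelianGroup c ℓ) where
  open AbelianGroup G renaming (refl to ≈-refl; sym to ≈-sym; trans to ≈-trans)
  open Multiples G
  open import Relation.Binary.Reasoning.Setoid setoid

  HasOrder : Carrier → ℕ → Set ℓ
  HasOrder x o = 0 < o × o · x ≈ ε × (∀ q → 0 < q → q · x ≈ ε → o ≤ q)

  order-unique : ∀ {x o o′} → HasOrder x o → HasOrder x o′ → o ≡ o′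
  order-unique (0<o , ox≈ε , o-min) (0<o′ , o′x≈ε , o′-min) = ≤-antisym (o-min _ 0<o′ o′x≈ε) (o′-min _ 0<o ox≈ε)

  HasOrder-cong : ∀ {x y o} → x ≈ y → HasOrder x o → HasOrder y o
  HasOrder-cong {o = o} x≈y (0<o , ox≈ε , o-min) =
    0<o , ≈-trans (·-congʳ o (≈-sym x≈y)) ox≈ε , λ q 0<q qy≈ε → o-min q 0<q (≈-trans (·-congʳ q x≈y) qy≈ε)

  order-multiple : ∀ {x o} → HasOrder x o → ∀ t → (t * o) · x ≈ ε
  order-multiple {x} {o} (_ , ox≈ε , _) t = ≈-trans (≈-sym (·-assoc t o x)) (≈-trans (·-congʳ t ox≈ε) (·-ε t))

  ·≈ε⇒order∣ : ∀ {x o q} → HasOrder x o → q · x ≈ ε → o ∣ q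
  ·≈ε⇒order∣ {x} {o} {q} x-order@(0<o , _ , o-min) qx≈ε = m%n≡0⇒n∣m q o {{nz}} (remainder≡0 (q % o) refl)
    where
      instance nz : NonZero o
      nz = >-nonZero 0<o
      rx≈ε : (q % o) · x ≈ ε
      rx≈ε = begin
        (q % o) · x                         ≈⟨ ≈-sym (identityʳ _) ⟩
        (q % o) · x ∙ ε                     ≈⟨ ∙-congˡ (≈-sym (order-multiple x-order (q / o))) ⟩
        (q % o) · x ∙ ((q / o) * o) · x     ≈⟨ ≈-sym (·-homo-+ (q % o) _ x) ⟩
        (q % o + (q / o) * o) · x           ≡⟨ cong (_· x) (sym (m≡m%n+[m/n]*n q o)) ⟩
        q · x                               ≈⟨ qx≈ε ⟩
        ε                                   ∎
      remainder≡0 : ∀ r → q % o ≡ r → r ≡ 0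
      remainder≡0 zero    _  = refl
      remainder≡0 (suc r) eq = contradiction (m%n<n q o)
        (≤⇒≯ (subst (o ≤_) (sym eq) (o-min (suc r) (s≤s z≤n) (subst (λ u → u · x ≈ ε) eq rx≈ε))))

  order∣⇒·≈ε : ∀ {x o q} → HasOrder x o → o ∣ q → q · x ≈ ε
  order∣⇒·≈ε x-order (divides t refl) = order-multiple x-order t

  order-· : ∀ {x a o} → HasOrder x (a * o) → 0 < a → HasOrder (a · x) o
  order-· {x} {a} {o} x-order@(0<ao , aox≈ε , _) 0<a = 0<o , oax≈ε , o-min
    where
      instance nz : NonZero a
      nz = >-nonZero 0<a
      0<o : 0 < o
      0<o = n≢0⇒n>0 λ { refl → contradiction (subst (0 <_) (*-zeroʳ a) 0<ao) (<-irrefl refl) }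
      oax≈ε : o · a · x ≈ ε
      oax≈ε = ≈-trans (·-assoc o a x) (≈-trans (reflexive (cong (_· x) (*-comm o a))) aox≈ε)
      o-min : ∀ q → 0 < q → q · a · x ≈ ε → o ≤ q
      o-min q 0<q qax≈ε = ∣⇒≤ {{>-nonZero 0<q}} (*-cancelˡ-∣ a (·≈ε⇒order∣ x-order
        (≈-trans (reflexive (cong (_· x) (*-comm a q))) (≈-trans (≈-sym (·-assoc q a x)) qax≈ε))))

  order-∙ : ∀ {x y a b} → Coprime a b → HasOrder x a → HasOrder y b → HasOrder (x ∙ y) (a * b)
  order-∙ {x} {y} {a} {b} a⊥b x-order@(0<a , _ , _) y-order@(0<b , _ , _) =
    *-mono-≤ 0<a 0<b , abxy≈ε , λ q 0<q qxy≈ε → ∣⇒≤ {{>-nonZero 0<q}} (coprime-*-∣ a⊥b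
      (coprime-order∣ x-order y-order a⊥b q (distribute q qxy≈ε))
      (coprime-order∣ y-order x-order (Coprime.sym a⊥b) q (≈-trans (comm _ _) (distribute q qxy≈ε))))
    where
      distribute : ∀ q → q · (x ∙ y) ≈ ε → q · x ∙ q · y ≈ ε
      distribute q e = ≈-trans (≈-sym (·-distrib-∙ q x y)) e
      abxy≈ε : (a * b) · (x ∙ y) ≈ ε
      abxy≈ε = begin
        (a * b) · (x ∙ y)              ≈⟨ ·-distrib-∙ (a * b) x y ⟩
        (a * b) · x ∙ (a * b) · y      ≈⟨ ∙-cong (≈-trans (reflexive (cong (_· x) (*-comm a b))) (order-multiple x-order b))
                                                 (order-multiple y-order a) ⟩
        ε ∙ ε                          ≈⟨ identityˡ ε ⟩
        ε                              ∎
      coprime-order∣ : ∀ {u v α β} → HasOrder u α → HasOrder v β → Coprime α β → ∀ q → q · u ∙ q · v ≈ ε → α ∣ q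
      coprime-order∣ {u} {v} {α} {β} u-order v-order α⊥β q quv≈ε = coprime-divisor α⊥β (·≈ε⇒order∣ u-order βqu≈ε)
        where
          βqv≈ε : β · q · v ≈ ε
          βqv≈ε = ≈-trans (·-assoc β q v) (≈-trans (reflexive (cong (_· v) (*-comm β q))) (order-multiple v-order q))
          βqu≈ε : (β * q) · u ≈ ε
          βqu≈ε = begin
            (β * q) · u                   ≈⟨ ≈-sym (·-assoc β q u) ⟩
            β · q · u                     ≈⟨ ≈-sym (identityʳ _) ⟩
            β · q · u ∙ ε                 ≈⟨ ∙-congˡ (≈-sym βqv≈ε) ⟩
            β · q · u ∙ β · q · v         ≈⟨ ≈-sym (·-distrib-∙ β _ _) ⟩
            β · (q · u ∙ q · v)           ≈⟨ ·-congʳ β quv≈ε ⟩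
            β · ε                         ≈⟨ ·-ε β ⟩
            ε                             ∎

  -- Split e = pᵇ e′ with p ∤ e′ for a prime p ∣ e: either pᵇ ∤ d and e′ · x is the witness,
  -- or e′ ∤ d and we recurse on pᵇ · x, of order e′.
  prime-power-order : ∀ d {x e} → HasOrder x e → ¬ e ∣ d →
                      ∃ λ z → ∃₂ λ p b → Prime p × HasOrder z (p ^ b) × ¬ p ^ b ∣ d
  prime-power-order d {x} {e} = <-rec P reduce e x
    where
      P : ℕ → Set _
      P e = ∀ x → HasOrder x e → ¬ e ∣ d → ∃ λ z → ∃₂ λ p b → Prime p × HasOrder z (p ^ b) × ¬ p ^ b ∣ d
      reduce : ∀ e → (∀ {e′} → e′ < e → P e′) → P e
      reduce e rec x x-order@(0<e , _ , _) e∤d with prime-divisor 1<e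
        where 1<e = ≤∧≢⇒< 0<e λ { refl → e∤d (1∣ d) }
      ... | p , pr , p∣e with prime-power-split pr 0<e
      ... | b , e′ , refl , p∤e′ with p ^ b ∣? d
      ...   | no pᵇ∤d = e′ · x , p , b , pr , order-· (subst (HasOrder x) (*-comm (p ^ b) e′) x-order) 0<e′ , pᵇ∤d
        where 0<e′ = m*n>0⇒n>0 (p ^ b) 0<e
      ...   | yes pᵇ∣d = rec e′<e ((p ^ b) · x) (order-· x-order 0<pᵇ) λ e′∣d →
              e∤d (coprime-*-∣ (coprime-^ b (prime∤⇒coprime pr p∤e′)) pᵇ∣d e′∣d)
        where
          0<pᵇ = m*n>0⇒m>0 (p ^ b) 0<e
          0<e′ = m*n>0⇒n>0 (p ^ b) 0<e
          e′<e : e′ < p ^ b * e′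
          e′<e = subst (e′ <_) (*-comm e′ (p ^ b)) (m<m*n e′ (p ^ b) {{>-nonZero 0<e′}} (prime-power>1 pr b p∣e p∤e′))

  larger-order : ∀ {g d z p} b → HasOrder g d → Prime p → HasOrder z (p ^ b) → ¬ p ^ b ∣ d →
                 ∃₂ λ y o → HasOrder y o × d < o
  larger-order {g} {d} {z} {p} b g-order@(0<d , _ , _) pr z-order pᵇ∤d with prime-power-split pr 0<d
  ... | a , d′ , refl , p∤d′ =
    (p ^ a) · g ∙ z , d′ * p ^ b ,
    order-∙ (Coprime.sym (coprime-^ b (prime∤⇒coprime pr p∤d′))) (order-· g-order 0<pᵃ) z-order ,
    subst (_< d′ * p ^ b) (*-comm d′ (p ^ a)) (*-monoʳ-< d′ {{>-nonZero 0<d′}} (^-monoʳ-< p (prime>1 pr) a<b))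
    where
      0<pᵃ = m*n>0⇒m>0 (p ^ a) 0<d
      0<d′ = m*n>0⇒n>0 (p ^ a) 0<d
      a<b : a < b
      a<b = ≰⇒> λ b≤a → pᵇ∤d (∣-trans (^-∣-^ p b≤a) (divides d′ (*-comm (p ^ a) d′)))

  module _ (_≈?_ : ∀ x y → Dec (x ≈ y)) where

    order-exists : ∀ {x m} → 0 < m → m · x ≈ ε → ∃ (HasOrder x)
    order-exists {x} {m} 0<m mx≈ε with least (λ q → (q · x) ≈? ε) 1 (suc m)
    ... | inj₁ none = contradiction mx≈ε (none m 0<m ≤-refl)
    ... | inj₂ (o , 0<o , _ , ox≈ε , o-min) = o , 0<o , ox≈ε , λ q 0<q qx≈ε → ≮⇒≥ λ q<o → o-min q 0<q q<o qx≈ε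

module _ {c ℓ} (G : AbelianGroup c ℓ) {k} (size : HasSize G k) {m} (exponent : IsExponent G m) where
  open AbelianGroup G renaming (refl to ≈-refl; sym to ≈-sym; trans to ≈-trans)
  open Multiples G
  open Orders G
  open Finite G size

  private
    0<m : 0 < m
    0<m = proj₁ exponent

    m-kills : ∀ x → m · x ≈ ε
    m-kills = proj₁ (proj₂ exponent)

    order : Carrier → ℕ
    order x = proj₁ (order-exists _≈?_ 0<m (m-kills x))

    order-correct : ∀ x → HasOrder x (order x)
    order-correct x = proj₂ (order-exists _≈?_ 0<m (m-kills x))

    order≤m : ∀ x → order x ≤ m
    order≤m x = proj₂ (proj₂ (order-correct x)) m 0<m (m-kills x)

    maximal-order : ∃ λ g → ∀ x → order x ≤ order g
    maximal-order with greatest (λ d → any? λ i → order (enum i) ℕ.≟ d) (suc m)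
    ... | inj₁ none = contradiction (index ε , refl) (none _ (s≤s (order≤m _)))
    ... | inj₂ (d , _ , (i , refl) , d-max) = enum i , λ x → ≮⇒≥ λ gx<x →
          d-max (order x) gx<x (s≤s (order≤m x)) (index x , order-unique
            (order-correct (enum (index x))) (HasOrder-cong (≈-sym (enum-index x)) (order-correct x)))

  -- An element of maximal order d kills every x: otherwise `larger-order` would beat d.
  exponent-attained : ∃ λ h → HasOrder h m
  exponent-attained = g , subst (HasOrder g) (≤-antisym (order≤m g) m≤d) (order-correct g)
    where
      g = proj₁ maximal-order
      d = order g
      d-kills : ∀ x → d · x ≈ ε
      d-kills x with (d · x) ≈? ε
      ... | yes dx≈ε = dx≈ε
      ... | no  dx≉ε with prime-power-order d (order-correct x) (dx≉ε ∘ order∣⇒·≈ε (order-correct x))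
      ...   | z , p , b , pr , z-order , pᵇ∤d with larger-order b (order-correct g) pr z-order pᵇ∤d
      ...     | y , o , y-order , d<o =
                contradiction (subst (_≤ d) (order-unique (order-correct y) y-order) (proj₂ maximal-order y)) (<⇒≱ d<o)
      m≤d : m ≤ d
      m≤d = proj₂ (proj₂ exponent) d (proj₁ (order-correct g)) d-kills

-- A zero-avoiding labelling of a short cycle

module Transversals {c ℓ} (G : AbelianGroup c ℓ) {k} (size : HasSize G k)
                    {m h} (h-order : Orders.HasOrder G h m) where
  open AbelianGroup G renaming (refl to ≈-refl; sym to ≈-sym; trans to ≈-trans)
  open import Algebra.Properties.AbelianGroup G using (∙-cancelˡ)
  open import Relation.Binary.Reasoning.Setoid setoid
  open Multiples G
  open Orders G
  open Finite G size

  private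
    instance
      m≢0 : NonZero m
      m≢0 = >-nonZero (proj₁ h-order)

    mh≈ε : m · h ≈ ε
    mh≈ε = proj₁ (proj₂ h-order)

    difference-kills : ∀ {a b} → a ≤ b → a · h ≈ b · h → (b ∸ a) · h ≈ ε
    difference-kills {a} {b} a≤b ah≈bh = ∙-cancelˡ (a · h) _ _ (begin
      a · h ∙ (b ∸ a) · h    ≈⟨ ≈-sym (·-homo-+ a (b ∸ a) h) ⟩
      (a + (b ∸ a)) · h      ≡⟨ cong (_· h) (m+[n∸m]≡n a≤b) ⟩
      b · h                  ≈⟨ ≈-sym ah≈bh ⟩
      a · h                  ≈⟨ ≈-sym (identityʳ _) ⟩
      a · h ∙ ε              ∎)

    ·h-injective-< : ∀ {a b} → a < b → b < m → ¬ a · h ≈ b · h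
    ·h-injective-< {a} {b} a<b b<m ah≈bh = <⇒≱ (≤-<-trans (m∸n≤m b a) b<m)
      (proj₂ (proj₂ h-order) (b ∸ a) (m<n⇒0<n∸m a<b) (difference-kills (<⇒≤ a<b) ah≈bh))

  ·h-injective : ∀ {a b} → a < m → b < m → a · h ≈ b · h → a ≡ b
  ·h-injective {a} {b} a<m b<m ah≈bh with <-cmp a b
  ... | tri< a<b _ _ = contradiction ah≈bh (·h-injective-< a<b b<m)
  ... | tri≈ _ a≡b _ = a≡b
  ... | tri> _ _ b<a = contradiction (≈-sym ah≈bh) (·h-injective-< b<a a<m)

  ·h-mod : ∀ q → q · h ≈ (q % m) · h
  ·h-mod q = begin
    q · h                              ≡⟨ cong (_· h) (m≡m%n+[m/n]*n q m) ⟩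
    (q % m + (q / m) * m) · h          ≈⟨ ·-homo-+ (q % m) _ h ⟩
    (q % m) · h ∙ ((q / m) * m) · h    ≈⟨ ∙-congˡ (order-multiple h-order (q / m)) ⟩
    (q % m) · h ∙ ε                    ≈⟨ identityʳ _ ⟩
    (q % m) · h                        ∎

  IsTransversal : ℕ → (ℕ → Carrier) → Set ℓ
  IsTransversal R c = c 0 ≈ ε × (∀ {q q′ a b} → q ≤ R → q′ ≤ R → a < m → b < m →
                                   c q ∙ a · h ≈ c q′ ∙ b · h → q ≡ q′ × a ≡ b)

  module _ {R : ℕ} (c : ℕ → Carrier) where

    private
      Covered : Carrier → Set ℓ
      Covered y = ∃₂ λ (q : Fin (suc R)) (a : Fin m) → c (toℕ q) ∙ toℕ a · h ≈ y

      covered? : ∀ y → Dec (Covered y)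
      covered? y = any? λ q → any? λ a → (c (toℕ q) ∙ toℕ a · h) ≈? y

      all-covered⇒k≤ : (∀ i → Covered (enum i)) → k ≤ m * suc R
      all-covered⇒k≤ cover =
        ≤-trans (injective⇒≤ (Injection.injective (↔⇒↣ (↔-sym *↔×) ↣-∘ mk↣ coords-injective)))
                (≤-reflexive (*-comm (suc R) m))
        where
          coords : Fin k → Fin (suc R) × Fin m
          coords i = proj₁ (cover i) , proj₁ (proj₂ (cover i))
          coords-injective : ∀ {i j} → coords i ≡ coords j → i ≡ j
          coords-injective {i} {j} eq = injective i j (≈-trans (≈-sym (proj₂ (proj₂ (cover i))))
            (≈-trans (reflexive (cong (λ (q , a) → c (toℕ q) ∙ toℕ a · h) eq)) (proj₂ (proj₂ (cover j)))))

    uncovered : m * suc R < k → ∃ λ y → ∀ {q a} → q ≤ R → a < m → ¬ c q ∙ a · h ≈ y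
    uncovered mR<k with any? (λ i → ¬? (covered? (enum i)))
    ... | yes (i , ¬covered) = enum i , λ {q} {a} q≤R a<m e → ¬covered (fromℕ< (s≤s q≤R) , fromℕ< a<m ,
          ≈-trans (reflexive (cong₂ (λ q a → c q ∙ a · h) (toℕ-fromℕ< (s≤s q≤R)) (toℕ-fromℕ< a<m))) e)
    ... | no none = contradiction (all-covered⇒k≤ λ i → decidable-stable (covered? (enum i)) (none ∘ (i ,_)))
                                  (<⇒≱ mR<k)

  extend : ℕ → (ℕ → Carrier) → Carrier → ℕ → Carrier
  extend R c y q with q ≤? R
  ... | yes _ = c q
  ... | no  _ = y

  private
    extend-old : ∀ {R c y q} → q ≤ R → extend R c y q ≡ c q
    extend-old {R} {q = q} q≤R with q ≤? R
    ... | yes _   = refl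
    ... | no  q≰R = contradiction q≤R q≰R

    extend-new : ∀ {R c y} → extend R c y (suc R) ≡ y
    extend-new {R} with suc R ≤? R
    ... | yes 1+R≤R = contradiction 1+R≤R 1+n≰n
    ... | no  _     = refl

    coset-of : ∀ {u a b} y → b < m → u ∙ a · h ≈ y ∙ b · h → y ≈ u ∙ ((a + (m ∸ b)) % m) · h
    coset-of {u} {a} {b} y b<m e = begin
      y                                ≈⟨ ≈-sym (identityʳ y) ⟩
      y ∙ ε                            ≈⟨ ∙-congˡ (≈-sym mh≈ε) ⟩
      y ∙ m · h                        ≡⟨ cong (λ t → y ∙ t · h) (sym (m+[n∸m]≡n (<⇒≤ b<m))) ⟩
      y ∙ (b + (m ∸ b)) · h            ≈⟨ ∙-congˡ (·-homo-+ b (m ∸ b) h) ⟩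
      y ∙ (b · h ∙ (m ∸ b) · h)        ≈⟨ ≈-sym (assoc _ _ _) ⟩
      (y ∙ b · h) ∙ (m ∸ b) · h        ≈⟨ ∙-congʳ (≈-sym e) ⟩
      (u ∙ a · h) ∙ (m ∸ b) · h        ≈⟨ assoc _ _ _ ⟩
      u ∙ (a · h ∙ (m ∸ b) · h)        ≈⟨ ∙-congˡ (≈-sym (·-homo-+ a (m ∸ b) h)) ⟩
      u ∙ (a + (m ∸ b)) · h            ≈⟨ ∙-congˡ (·h-mod _) ⟩
      u ∙ ((a + (m ∸ b)) % m) · h      ∎

  extend-transversal : ∀ {R c y} → IsTransversal R c → (∀ {q a} → q ≤ R → a < m → ¬ c q ∙ a · h ≈ y) →
                       IsTransversal (suc R) (extend R c y)
  extend-transversal {R} {c} {y} (c0≈ε , c-injective) y-new = ≈-trans (reflexive (old z≤n)) c0≈ε , injective′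
    where
      c′ = extend R c y

      old : ∀ {q} → q ≤ R → c′ q ≡ c q
      old = extend-old {R} {c} {y}

      new-coset : ∀ {q a b} → q ≤ R → b < m → ¬ c q ∙ a · h ≈ y ∙ b · h
      new-coset {a = a} q≤R b<m e = y-new q≤R (m%n<n _ m) (≈-sym (coset-of {a = a} y b<m e))

      new-at : ∀ {q} → q ≡ suc R → c′ q ≡ y
      new-at refl = extend-new {R} {c} {y}

      injective′ : ∀ {q q′ a b} → q ≤ suc R → q′ ≤ suc R → a < m → b < m →
                   c′ q ∙ a · h ≈ c′ q′ ∙ b · h → q ≡ q′ × a ≡ b
      injective′ {q} {q′} {a} {b} q≤ q′≤ a<m b<m e = cases (m≤n⇒m<n∨m≡n q≤) (m≤n⇒m<n∨m≡n q′≤)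
        where
          relabel : ∀ {u v} → c′ q ≡ u → c′ q′ ≡ v → u ∙ a · h ≈ v ∙ b · h
          relabel refl refl = e

          cases : q < suc R ⊎ q ≡ suc R → q′ < suc R ⊎ q′ ≡ suc R → q ≡ q′ × a ≡ b
          cases (inj₁ (s≤s q≤R)) (inj₁ (s≤s q′≤R)) = c-injective q≤R q′≤R a<m b<m (relabel (old q≤R) (old q′≤R))
          cases (inj₁ (s≤s q≤R)) (inj₂ q′≡)        =
            contradiction (relabel (old q≤R) (new-at q′≡)) (new-coset {a = a} q≤R b<m)
          cases (inj₂ q≡)        (inj₁ (s≤s q′≤R)) =
            contradiction (≈-sym (relabel (new-at q≡) (old q′≤R))) (new-coset {a = b} q′≤R a<m)
          cases (inj₂ q≡)        (inj₂ q′≡)        =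
            trans q≡ (sym q′≡) , ·h-injective a<m b<m (∙-cancelˡ y _ _ (relabel (new-at q≡) (new-at q′≡)))

  transversal : ∀ R → m * R < k → ∃ (IsTransversal R)
  transversal zero _ = (λ _ → ε) , ≈-refl , λ { z≤n z≤n a<m b<m e → refl , ·h-injective a<m b<m (∙-cancelˡ ε _ _ e) }
  transversal (suc R) mR<k with transversal R (≤-<-trans (*-monoʳ-≤ m (n≤1+n R)) mR<k)
  ... | c , c-transversal with uncovered c mR<k
  ...   | y , y-new = extend R c y , extend-transversal c-transversal y-new

module Coordinates (M : ℕ) .{{_ : NonZero M}} (n : ℕ) where

  -- Position t ≤ n stands for r (t / M) + (t % M) · h, the last position for r 0 + M · h = - h.
  coordinates : ℕ → ℕ × ℕ
  coordinates t with t ≤? n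
  ... | yes _ = t / M , t % M
  ... | no  _ = 0 , M

  -- The coordinates of the sum of an element with - h.
  shift : ℕ × ℕ → ℕ × ℕ
  shift (q , zero)  = q , M
  shift (q , suc a) = q , a

  coordinates-≤ : ∀ {t} → t ≤ n → coordinates t ≡ (t / M , t % M)
  coordinates-≤ {t} t≤n with t ≤? n
  ... | yes _   = refl
  ... | no  t≰n = contradiction t≤n t≰n

  coordinates-last : coordinates (suc n) ≡ (0 , M)
  coordinates-last with suc n ≤? n
  ... | yes 1+n≤n = contradiction 1+n≤n 1+n≰n
  ... | no  _     = refl

  Bounded : ℕ × ℕ → Set
  Bounded (q , a) = q ≤ n / M × a ≤ M

  coordinates-bounded : ∀ {t} → t ≤ suc n → Bounded (coordinates t)
  coordinates-bounded {t} t≤1+n with m≤n⇒m<n∨m≡n t≤1+n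
  ... | inj₁ (s≤s t≤n) rewrite coordinates-≤ t≤n = /-monoˡ-≤ M t≤n , <⇒≤ (m%n<n t M)
  ... | inj₂ refl      rewrite coordinates-last  = z≤n , ≤-refl

  shift-bounded : ∀ {p} → Bounded p → Bounded (shift p)
  shift-bounded {_ , zero}  (q≤ , _)   = q≤ , ≤-refl
  shift-bounded {_ , suc a} (q≤ , a<M) = q≤ , <⇒≤ a<M

  private
    split : ∀ t → t ≡ t % M + (t / M) * M
    split t = m≡m%n+[m/n]*n t M

    digit≢M : ∀ t → t % M ≢ M
    digit≢M t eq = <-irrefl eq (m%n<n t M)

  coordinates-injective : ∀ {i j} → i ≤ suc n → j ≤ suc n → coordinates i ≡ coordinates j → i ≡ j
  coordinates-injective {i} {j} i≤1+n j≤1+n eq with m≤n⇒m<n∨m≡n i≤1+n | m≤n⇒m<n∨m≡n j≤1+n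
  ... | inj₁ (s≤s i≤n) | inj₁ (s≤s j≤n) rewrite coordinates-≤ i≤n | coordinates-≤ j≤n =
    trans (split i) (trans (cong₂ (λ r q → r + q * M) (cong proj₂ eq) (cong proj₁ eq)) (sym (split j)))
  ... | inj₁ (s≤s i≤n) | inj₂ refl rewrite coordinates-≤ i≤n | coordinates-last =
    contradiction (cong proj₂ eq) (digit≢M i)
  ... | inj₂ refl | inj₁ (s≤s j≤n) rewrite coordinates-≤ j≤n | coordinates-last =
    contradiction (sym (cong proj₂ eq)) (digit≢M j)
  ... | inj₂ refl | inj₂ refl = refl

  private
    shift-M : ∀ q → shift (q , M) ≡ (q , pred M)
    shift-M q = cong (λ a → shift (q , a)) (sym (suc-pred M))

    ≢-shift-digits : ∀ {i j} → 0 < i → i ≤ j → j ≤ suc n → coordinates j ≢ shift (i / M , i % M)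
    ≢-shift-digits {i} {j} 0<i i≤j j≤1+n eq with i % M in i%M≡ | m≤n⇒m<n∨m≡n j≤1+n
    ... | zero  | inj₁ (s≤s j≤n) rewrite coordinates-≤ j≤n = digit≢M j (cong proj₂ eq)
    ... | zero  | inj₂ refl rewrite coordinates-last = <-irrefl (sym i≡0) 0<i
      where
        i≡0 : i ≡ 0
        i≡0 = trans (split i) (cong₂ (λ r q → r + q * M) i%M≡ (sym (cong proj₁ eq)))
    ... | suc a | inj₁ (s≤s j≤n) rewrite coordinates-≤ j≤n = <⇒≱ j<i i≤j
      where
        j<i : j < i
        j<i = subst₂ _<_ (sym (trans (split j) (cong₂ (λ r q → r + q * M) (cong proj₂ eq) (cong proj₁ eq))))
                        (sym (trans (split i) (cong (_+ (i / M) * M) i%M≡))) (n<1+n _)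
    ... | suc a | inj₂ refl rewrite coordinates-last =
      <-irrefl (sym (cong proj₂ eq)) (<-trans (n<1+n a) (subst (_< M) i%M≡ (m%n<n i M)))

  coordinates≢shift : ∀ {i j} → 0 < i → i ≤ j → j ≤ suc n → coordinates j ≢ shift (coordinates i)
  coordinates≢shift {i} {j} 0<i i≤j j≤1+n with m≤n⇒m<n∨m≡n (≤-trans i≤j j≤1+n)
  ... | inj₁ (s≤s i≤n) rewrite coordinates-≤ i≤n = ≢-shift-digits 0<i i≤j j≤1+n
  ... | inj₂ refl rewrite ≤-antisym j≤1+n i≤j | coordinates-last | shift-M 0 =
    λ eq → <-irrefl (sym (cong proj₂ eq)) (subst (pred M <_) (suc-pred M) (n<1+n (pred M)))

module Construction {c ℓ} (G : AbelianGroup c ℓ) {k} (size : HasSize G k)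
                    (M : ℕ) .{{_ : NonZero M}} {h} (h-order : Orders.HasOrder G h (suc M))
                    (n : ℕ) (few-vertices : suc M * n < M * k) where
  open AbelianGroup G renaming (refl to ≈-refl; sym to ≈-sym; trans to ≈-trans)
  private
    module ≈-Reasoning = Relation.Binary.Reasoning.Setoid setoid
  open Multiples G
  open Transversals G size h-order
  open Coordinates M n
  open Cycle n using (N)

  private
    R : ℕ
    R = n / M

    mR<k : suc M * R < k
    mR<k = *-cancelˡ-< M (suc M * R) k (≤-<-trans (begin
      M * (suc M * R)   ≡⟨ sym (*-assoc M (suc M) R) ⟩
      M * suc M * R     ≡⟨ cong (_* R) (*-comm M (suc M)) ⟩
      suc M * M * R     ≡⟨ *-assoc (suc M) M R ⟩
      suc M * (M * R)   ≡⟨ cong (suc M *_) (*-comm M R) ⟩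
      suc M * (R * M)   ≤⟨ *-monoʳ-≤ (suc M) (m/n*n≤m n M) ⟩
      suc M * n         ∎) few-vertices)
      where open ≤-Reasoning

    rep : ℕ → Carrier
    rep = proj₁ (transversal R mR<k)

    rep0≈ε : rep 0 ≈ ε
    rep0≈ε = proj₁ (proj₂ (transversal R mR<k))

    rep-injective : ∀ {q q′ a b} → q ≤ R → q′ ≤ R → a < suc M → b < suc M →
                    rep q ∙ a · h ≈ rep q′ ∙ b · h → q ≡ q′ × a ≡ b
    rep-injective = proj₂ (proj₂ (transversal R mR<k))

    ρ : ℕ × ℕ → Carrier
    ρ (q , a) = rep q ∙ a · h

    ρ-injective : ∀ {p p′} → Bounded p → Bounded p′ → ρ p ≈ ρ p′ → p ≡ p′
    ρ-injective (q≤R , a≤M) (q′≤R , b≤M) e with rep-injective q≤R q′≤R (s≤s a≤M) (s≤s b≤M) e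
    ... | q≡q′ , a≡b = cong₂ _,_ q≡q′ a≡b

    ρ∙ρ[0,M] : ∀ q a → ρ (q , a) ∙ ρ (0 , M) ≈ rep q ∙ (a + M) · h
    ρ∙ρ[0,M] q a = begin
      (rep q ∙ a · h) ∙ (rep 0 ∙ M · h)   ≈⟨ ∙-congˡ (≈-trans (∙-congʳ rep0≈ε) (identityˡ _)) ⟩
      (rep q ∙ a · h) ∙ M · h             ≈⟨ assoc _ _ _ ⟩
      rep q ∙ (a · h ∙ M · h)             ≈⟨ ∙-congˡ (≈-sym (·-homo-+ a M h)) ⟩
      rep q ∙ (a + M) · h                 ∎
      where open ≈-Reasoning

    ρ-shift : ∀ p → ρ p ∙ ρ (0 , M) ≈ ρ (shift p)
    ρ-shift (q , zero)  = ρ∙ρ[0,M] q zero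
    ρ-shift (q , suc a) = ≈-trans (ρ∙ρ[0,M] q (suc a)) (∙-congˡ (begin
      (suc a + M) · h         ≡⟨ cong (_· h) (sym (+-suc a M)) ⟩
      (a + suc M) · h         ≈⟨ ·-homo-+ a (suc M) h ⟩
      a · h ∙ suc M · h       ≈⟨ ∙-congˡ (proj₁ (proj₂ h-order)) ⟩
      a · h ∙ ε               ≈⟨ identityʳ _ ⟩
      a · h                   ∎))
      where open ≈-Reasoning

    σ : ℕ → Carrier
    σ t = ρ (coordinates t)

    σ0≈ε : σ 0 ≈ ε
    σ0≈ε = begin
      ρ (coordinates 0)   ≡⟨ cong ρ (trans (coordinates-≤ z≤n) (cong₂ _,_ (0/n≡0 M) (m<n⇒m%n≡m (>-nonZero⁻¹ M)))) ⟩
      rep 0 ∙ ε           ≈⟨ identityʳ _ ⟩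
      rep 0               ≈⟨ rep0≈ε ⟩
      ε                   ∎
      where open ≈-Reasoning

    σ-injective : ∀ {i j} → i ≤ N → j ≤ N → σ i ≈ σ j → i ≡ j
    σ-injective i≤N j≤N e =
      coordinates-injective i≤N j≤N (ρ-injective (coordinates-bounded i≤N) (coordinates-bounded j≤N) e)

  labelling : Fin N → Carrier
  labelling = differences G σ

  private
    prefix≈σ : ∀ {t} → t ≤ N → sumBelow G labelling t ≈ σ t
    prefix≈σ = sumBelow-differences G σ σ0≈ε

    total≈ρ : sumAll G labelling ≈ ρ (0 , M)
    total≈ρ = ≈-trans (≈-sym (sumBelow-all G labelling))
                      (≈-trans (prefix≈σ ≤-refl) (reflexive (cong ρ coordinates-last)))

    condition : PrefixSumCondition G n labelling
    condition = record { distinct = distinct ; no-wrap = no-wrap }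
      where
        distinct : ∀ {i j} → i < j → j ≤ N → ¬ sumBelow G labelling i ≈ sumBelow G labelling j
        distinct {i} {j} i<j j≤N e =
          <-irrefl (σ-injective i≤N j≤N (≈-trans (≈-sym (prefix≈σ i≤N)) (≈-trans e (prefix≈σ j≤N)))) i<j
          where i≤N = <⇒≤ (<-≤-trans i<j j≤N)
        no-wrap : ∀ {i j} → 0 < i → i ≤ j → j ≤ N →
                  ¬ sumBelow G labelling j ≈ sumBelow G labelling i ∙ sumAll G labelling
        no-wrap {i} {j} 0<i i≤j j≤N e = coordinates≢shift 0<i i≤j j≤N
          (ρ-injective (coordinates-bounded j≤N) (shift-bounded (coordinates-bounded i≤N)) (begin
            σ j                                              ≈⟨ ≈-sym (prefix≈σ j≤N) ⟩
            sumBelow G labelling j                           ≈⟨ e ⟩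
            sumBelow G labelling i ∙ sumAll G labelling      ≈⟨ ∙-cong (prefix≈σ i≤N) total≈ρ ⟩
            σ i ∙ ρ (0 , M)                                  ≈⟨ ρ-shift (coordinates i) ⟩
            ρ (shift (coordinates i))                        ∎))
          where
            open ≈-Reasoning
            i≤N = ≤-trans i≤j j≤N

  labelling-zeroAvoiding : ZeroAvoiding G (cycleGraph N) labelling
  labelling-zeroAvoiding = prefixSumCondition⇒zeroAvoiding G n condition

module _ {c ℓ} (G : AbelianGroup c ℓ) {k} (size : HasSize G k) where
  open AbelianGroup G renaming (refl to ≈-refl; sym to ≈-sym; trans to ≈-trans)
  open Multiples G using (_·_)

  zeroAvoiding⇒count : ∀ m .{{_ : NonZero m}} → (∀ x → m · x ≈ ε) → ∀ n {lab} →
                       ZeroAvoiding G (cycleGraph (suc n)) lab → k + m * suc n ≤ m * k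
  zeroAvoiding⇒count m m-kills n {lab} avoiding = count G size m {T = T} (m-kills T) s s-injective descending
    where

      open PrefixSumCondition (zeroAvoiding⇒prefixSumCondition G n avoiding)
      T = sumAll G lab

      s : Fin (suc n) → Carrier
      s t = sumBelow G lab (suc (toℕ t))

      s-injective : ∀ {i j} → s i ≈ s j → i ≡ j
      s-injective {i} {j} e with <-cmp (toℕ i) (toℕ j)
      ... | tri< i<j _ _ = contradiction e (distinct (s≤s i<j) (toℕ<n j))
      ... | tri≈ _ i≡j _ = toℕ-injective i≡j
      ... | tri> _ _ j<i = contradiction (≈-sym e) (distinct (s≤s j<i) (toℕ<n i))

      descending : ∀ {i j} → s j ≈ s i ∙ T → toℕ j < toℕ i
      descending {i} {j} e = ≰⇒> λ i≤j → no-wrap (s≤s z≤n) (s≤s i≤j) (toℕ<n j) e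

bound⇒zeroForcing : ∀ {c ℓ} (G : AbelianGroup c ℓ) {k m} → HasSize G k → IsExponent G m →
                    ∀ n → m + (m ∸ 1) * k ≤ m * suc n → ZeroForcing G (cycleGraph (suc n))
bound⇒zeroForcing G {m = zero}  _    (() , _)          _ _
bound⇒zeroForcing G {k} {suc M} size (_ , m-kills , _) n bound lab avoiding =
  <⇒≱ (m<n+m (M * k) (s≤s z≤n))
      (≤-trans bound (+-cancelˡ-≤ k _ _ (zeroAvoiding⇒count G size (suc M) m-kills n avoiding)))

zeroForcing⇒bound : ∀ {c ℓ} (G : AbelianGroup c ℓ) {k m} → HasSize G k → IsExponent G m →
                    ∀ n → ZeroForcing G (cycleGraph (suc n)) → m + (m ∸ 1) * k ≤ m * suc n
zeroForcing⇒bound G {m = zero}        _    (() , _) _ _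
zeroForcing⇒bound G {m = suc zero}    _    _        _ _ = s≤s z≤n
zeroForcing⇒bound G {k} {suc (suc M)} size exponent n forcing
  with suc (suc M) + suc M * k ≤? suc (suc M) * suc n
... | yes bound  = bound
... | no  ¬bound = contradiction (Construction.labelling-zeroAvoiding G size (suc M) h-order n few-vertices) (forcing _)
  where
    h-order = proj₂ (exponent-attained G size exponent)
    few-vertices : suc (suc M) * n < suc M * k
    few-vertices = +-cancelˡ-< (suc (suc M)) _ _
      (subst (_< suc (suc M) + suc M * k) (*-suc (suc (suc M)) n) (≰⇒> ¬bound))

theorem6p2 : {c ℓ : Level} (G : AbelianGroup c ℓ) (k m : ℕ) →
    HasSize G k → IsExponent G m →
    (n : ℕ) → 3 ≤ n →
    (ZeroForcing G (cycleGraph n) → m + (m ∸ 1) * k ≤ m * n) ×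
    (m + (m ∸ 1) * k ≤ m * n → ZeroForcing G (cycleGraph n))
theorem6p2 G k m size exponent zero    ()
theorem6p2 G k m size exponent (suc n) _ = zeroForcing⇒bound G size exponent n , bound⇒zeroForcing G size exponent n
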